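{- Let $\pi=(\pi_1,\dots,\pi_n)$ be any arrival order and let $A^i$ be Greedy's allocation of $\pi_1,\dots,\pi_i$ (so $A^0$ is empty). Then for every $i$, Greedy's increase in welfare from allocating item $\pi_i$, namely $V(A^i)-V(A^{i-1})$, is at least $\sum_{j\in N}\big(Gain(j,A^{i-1})-Gain(j,A^i)\big)$.
   Context: Online SWM: items $N$ ($|N|=n$), agents $M$, agent $\ell$ has monotone submodular valuation $v_\ell:2^N\to\mathbb{R}_{\ge0}$, $v_\ell(\emptyset)=0$. Greedy assigns each arriving item to an agent maximizing the marginal increase of that agent's valuation. An allocation $A=(A_\ell)$ consists of disjoint item sets (some items may be unallocated), with value $V(A)=\sum_\ell v_\ell(A_\ell)$. Fix an optimal allocation $A^*$; $opt_j$ denotes the agent with $j\in A^*_{opt_j}$. Fix an arbitrary permutation $\sigma$ of the items, $\sigma^i$ its first $i$ items. For item $j$ at position $i+1$ of $\sigma$ and $\ell=opt_j$: $Gain(j,A)=v_\ell(\{j\}\cup A_\ell\cup(A^*_\ell\cap\sigma^i))-v_\ell(A_\ell\cup(A^*_\ell\cap\sigma^i))$. -}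

module Defs where

open import Level using (Level; _⊔_) renaming (suc to lsuc)
open import Algebra.Bundles using (AbelianGroup)
open import Relation.Binary.Core using (Rel)
open import Relation.Binary.Structures using (IsTotalOrder)
open import Data.Nat.Base using (ℕ; zero; suc)
import Data.Nat.Properties as ℕP
open import Data.Fin.Base using (Fin; toℕ)
open import Data.Fin.Properties using (_≟_)
open import Data.Fin.Subset using (Subset; ⊥; ⁅_⁆; _∪_; _∩_; _⊆_; _∉_)
open import Data.Vec.Base using (tabulate)
open import Data.Maybe.Base using (Maybe; just; nothing)
open import Data.Maybe.Properties using (≡-dec)
open import Data.Bool.Base using (if_then_else_)
open import Relation.Nullary.Decidable using (does)
open import Function.Bundles using (_↔_; Inverse)

-- A totally ordered abelian group (the real numbers under + are one).
-- Valuations take values in such a group; the paper's setting is the reals.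
record OrderedAbelianGroup (c ℓ₁ ℓ₂ : Level) : Set (lsuc (c ⊔ ℓ₁ ⊔ ℓ₂)) where
  field
    abelianGroup : AbelianGroup c ℓ₁
  open AbelianGroup abelianGroup public
  infix 4 _≤_
  field
    _≤_ : Rel Carrier ℓ₂
    isTotalOrder : IsTotalOrder _≈_ _≤_
    ∙-monoˡ-≤ : ∀ {x y} z → x ≤ y → (x ∙ z) ≤ (y ∙ z)

module Setting {c ℓ₁ ℓ₂ : Level} (G : OrderedAbelianGroup c ℓ₁ ℓ₂) where
  open OrderedAbelianGroup G

  sumFin : ∀ k → (Fin k → Carrier) → Carrier
  sumFin zero    f = ε
  sumFin (suc k) f = f Fin.zero ∙ sumFin k (λ i → f (Fin.suc i))

  marginal : ∀ {n} → (Subset n → Carrier) → Subset n → Fin n → Carrier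
  marginal v S j = v (⁅ j ⁆ ∪ S) - v S

  record IsMonotoneSubmodular {n} (v : Subset n → Carrier) : Set (c ⊔ ℓ₁ ⊔ ℓ₂) where
    field
      empty≈0    : v ⊥ ≈ ε
      nonneg     : ∀ S → ε ≤ v S
      monotone   : ∀ S T → S ⊆ T → v S ≤ v T
      submodular : ∀ S T j → S ⊆ T → j ∉ T → marginal v T j ≤ marginal v S j

  -- An allocation of items Fin n to agents Fin m: each item goes to at most
  -- one agent (nothing = unallocated). Disjointness is built in.
  Allocation : ℕ → ℕ → Set
  Allocation n m = Fin n → Maybe (Fin m)

  bundle : ∀ {n m} → Allocation n m → Fin m → Subset n
  bundle A ℓ = tabulate (λ j → does (≡-dec _≟_ (A j) (just ℓ)))

  welfare : ∀ {n m} → (Fin m → Subset n → Carrier) → Allocation n m → Carrier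
  welfare {m = m} vs A = sumFin m (λ ℓ → vs ℓ (bundle A ℓ))

  IsOptimal : ∀ {n m} → (Fin m → Subset n → Carrier) → Allocation n m → Set (ℓ₂)
  IsOptimal vs A* = ∀ B → welfare vs B ≤ welfare vs A*

  -- A permutation σ of the items: Inverse.to maps positions (0-based) to
  -- items, Inverse.from maps an item to its position.
  -- σ^i = the first i items of σ
  prefix : ∀ {n} → (Fin n ↔ Fin n) → ℕ → Subset n
  prefix σ i = tabulate (λ j → does (toℕ (Inverse.from σ j) ℕP.<? i))

  -- Gain(j, A) w.r.t. the optimal allocation A* and permutation σ;
  -- taken to be 0 if j is unallocated in A* (opt_j undefined).
  Gain : ∀ {n m} → (Fin m → Subset n → Carrier) → Allocation n m →
         (Fin n ↔ Fin n) → Fin n → Allocation n m → Carrier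
  Gain vs A* σ j A with A* j
  ... | nothing = ε
  ... | just ℓ  = marginal (vs ℓ)
                    (bundle A ℓ ∪ (bundle A* ℓ ∩ prefix σ (toℕ (Inverse.from σ j)))) j

  -- Greedy run on arrival order π (Inverse.to π p = π_{p+1}), recorded by the
  -- agent c p chosen for the item at position p. A^k = allocation of the
  -- first k arrived items.
  greedyAlloc : ∀ {n m} → (Fin n ↔ Fin n) → (Fin n → Fin m) → ℕ → Allocation n m
  greedyAlloc π c k j =
    if does (toℕ (Inverse.from π j) ℕP.<? k) then just (c (Inverse.from π j)) else nothing

  IsGreedy : ∀ {n m} → (Fin m → Subset n → Carrier) → (Fin n ↔ Fin n) →
             (Fin n → Fin m) → Set ℓ₂
  IsGreedy vs π c = ∀ p ℓ →
    marginal (vs ℓ) (bundle (greedyAlloc π c (toℕ p)) ℓ) (Inverse.to π p)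
      ≤ marginal (vs (c p)) (bundle (greedyAlloc π c (toℕ p)) (c p)) (Inverse.to π p)

module Submission where

-- Fix an allocation A and an agent ℓ, and add the items of A*_ℓ to A_ℓ one at a time in
-- the order σ.  The increase of v_ℓ when the item j is added is exactly Gain(j, A), so
-- Σ_j Gain(j, A) telescopes to Σ_ℓ (v_ℓ(A_ℓ ∪ A*_ℓ) − v_ℓ(A_ℓ)).  Greedy's allocations are
-- nested, A^{i−1}_ℓ ⊆ A^i_ℓ, so by monotonicity the terms v_ℓ(A_ℓ ∪ A*_ℓ) do not decrease
-- from A^{i−1} to A^i, and the difference of the two telescoped sums is at most
-- Σ_ℓ (v_ℓ(A^i_ℓ) − v_ℓ(A^{i−1}_ℓ)) = V(A^i) − V(A^{i−1}).

open import Defs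
open import Level using (Level)
open import Data.Nat.Base using (ℕ; suc)
open import Data.Fin.Base using (Fin; toℕ)
open import Data.Fin.Subset using (Subset)
open import Function.Bundles using (_↔_)

import Algebra.Properties.AbelianGroup as AbelianGroupProperties
import Algebra.Properties.CommutativeMonoid.Sum as CommutativeMonoidSum
import Algebra.Solver.CommutativeMonoid as CommutativeMonoidSolver
import Data.Nat.Base as ℕ
import Data.Nat.Properties as ℕₚ
open import Data.Bool.Base using (true; if_then_else_)
open import Data.Fin.Base using (zero; suc; punchIn)
open import Data.Fin.Properties using (toℕ<n; toℕ-injective; punchInᵢ≢i)
  renaming (_≟_ to _≟ᶠ_)
open import Data.Fin.Subset using (⊥; ⊤; ⁅_⁆; _∪_; _∩_; _⊆_; _∈_; _∉_)
open import Data.Fin.Subset.Properties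
  using ( ⊆-antisym; ⊥⊆; ⊆⊤; x∈⁅x⁆; x∈⁅y⁆⇒x≡y
        ; p⊆p∪q; q⊆p∪q; x∈p∪q⁺; x∈p∪q⁻; x∈p∩q⁺; p∩q⊆p; p∩q⊆q
        ; ∪-assoc; ∪-comm; ∪-identityˡ; ∪-identityʳ; ∩-distribˡ-∪; ∩-zeroʳ; ∩-identityʳ)
open import Data.Maybe.Base using (Maybe; just; nothing)
open import Data.Maybe.Properties using (≡-dec; just-injective)
open import Data.Product.Base using (_,_)
open import Data.Sum.Base using (inj₁; inj₂)
open import Data.Vec.Base using (tabulate)
open import Data.Vec.Properties using (lookup∘tabulate; []=⇒lookup; lookup⇒[]=)
open import Function.Base using (_∘_)
open import Function.Bundles using (Inverse; _⇔_; mk⇔; Equivalence)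
open import Relation.Binary.Bundles using (Poset)
open import Relation.Binary.PropositionalEquality as ≡ using (_≡_; _≢_)
open import Relation.Binary.Structures using (IsTotalOrder; IsPreorder)
open import Relation.Nullary.Decidable using (Dec; yes; no; does; proof; dec-true)
open import Relation.Nullary.Negation using (contradiction)
open import Relation.Nullary.Reflects using (Reflects; invert)
open import Relation.Unary using (Pred; Decidable)

private
  variable
    n : ℕ
    p q r : Subset n
    x : Fin n

x∈tabulate⇔ : ∀ {a} {P : Pred (Fin n) a} (P? : Decidable P) →
              x ∈ tabulate (λ y → does (P? y)) ⇔ P x
x∈tabulate⇔ {x = x} P? = mk⇔
  (λ x∈ → invert (≡.subst (Reflects _) (does≡true x∈) (proof (P? x))))
  (λ Px → lookup⇒[]= x _ (≡.trans (lookup∘tabulate _ x) (dec-true (P? x) Px)))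
  where
  does≡true : x ∈ tabulate (λ y → does (P? y)) → does (P? x) ≡ true
  does≡true x∈ = ≡.trans (≡.sym (lookup∘tabulate _ x)) ([]=⇒lookup x∈)

p∩⁅x⁆≡⁅x⁆ : x ∈ p → p ∩ ⁅ x ⁆ ≡ ⁅ x ⁆
p∩⁅x⁆≡⁅x⁆ x∈p = ⊆-antisym (p∩q⊆q _ _)
  (λ y∈ → x∈p∩q⁺ (≡.subst (_∈ _) (≡.sym (x∈⁅y⁆⇒x≡y _ y∈)) x∈p , y∈))

p∩⁅x⁆≡⊥ : x ∉ p → p ∩ ⁅ x ⁆ ≡ ⊥
p∩⁅x⁆≡⊥ {p = p} x∉p = ⊆-antisym x∈p∩⁅x⁆-absurd ⊥⊆
  where
  x∈p∩⁅x⁆-absurd : p ∩ ⁅ _ ⁆ ⊆ ⊥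
  x∈p∩⁅x⁆-absurd y∈ =
    contradiction (≡.subst (_∈ p) (x∈⁅y⁆⇒x≡y _ (p∩q⊆q _ _ y∈)) (p∩q⊆p _ _ y∈)) x∉p

∪-monoˡ-⊆ : p ⊆ q → p ∪ r ⊆ q ∪ r
∪-monoˡ-⊆ {p = p} {q} {r} p⊆q x∈ with x∈p∪q⁻ p r x∈
... | inj₁ x∈p = p⊆p∪q r (p⊆q x∈p)
... | inj₂ x∈r = q⊆p∪q q r x∈r

∪-leftComm : (p q r : Subset n) → p ∪ (q ∪ r) ≡ q ∪ (p ∪ r)
∪-leftComm p q r =
  ≡.trans (≡.sym (∪-assoc p q r)) (≡.trans (≡.cong (_∪ r) (∪-comm p q)) (∪-assoc q p r))

if-does-just-mono : ∀ {a p q} {A : Set a} {P : Set p} {Q : Set q} (P? : Dec P) (Q? : Dec Q)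
                    {y : Maybe A} {z} → (P → Q) →
                    (if does P? then y else nothing) ≡ just z →
                    (if does Q? then y else nothing) ≡ just z
if-does-just-mono (yes _) (yes _)  _   y≡z = y≡z
if-does-just-mono (yes P) (no ¬Q)  P⇒Q _   = contradiction (P⇒Q P) ¬Q
if-does-just-mono (no _)  _        _   ()

module WelfareAccounting {c ℓ₁ ℓ₂ : Level} (G : OrderedAbelianGroup c ℓ₁ ℓ₂) where
  open OrderedAbelianGroup G
  open Setting G
  open AbelianGroupProperties abelianGroup using (⁻¹-anti-homo‿-; ⁻¹-∙-comm; ε⁻¹≈ε)
  open CommutativeMonoidSum commutativeMonoid
    using (sum; sum-cong-≋; sum-replicate-zero; sum-remove; ∑-distrib-+; ∑-comm; ∑-permute)
  open CommutativeMonoidSolver commutativeMonoid using (solve; _⊕_; _⊜_)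
  open IsTotalOrder isTotalOrder using (isPartialOrder; isPreorder)
  open IsPreorder isPreorder
    using (∼-respˡ-≈; ∼-respʳ-≈) renaming (refl to ≤-refl; trans to ≤-trans)

  poset : Poset c ℓ₁ ℓ₂
  poset = record { isPartialOrder = isPartialOrder }

  private
    variable
      m : ℕ

  ∙-mono-≤ : ∀ {a b u v} → a ≤ b → u ≤ v → a ∙ u ≤ b ∙ v
  ∙-mono-≤ {a} {b} {u} {v} a≤b u≤v =
    ≤-trans (∙-monoˡ-≤ u a≤b)
            (∼-respˡ-≈ (comm u b) (∼-respʳ-≈ (comm v b) (∙-monoˡ-≤ b u≤v)))

  x≤y⇒x-y≤ε : ∀ {a b} → a ≤ b → a - b ≤ ε
  x≤y⇒x-y≤ε {b = b} a≤b = ∼-respʳ-≈ (inverseʳ b) (∙-monoˡ-≤ (b ⁻¹) a≤b)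

  wx∙yz≈yx∙wz : ∀ w x y z → (w ∙ x) ∙ (y ∙ z) ≈ (y ∙ x) ∙ (w ∙ z)
  wx∙yz≈yx∙wz = solve 4 (λ w x y z → (w ⊕ x) ⊕ (y ⊕ z) ⊜ (y ⊕ x) ⊕ (w ⊕ z)) refl

  [b-a]∙[d-b]≈d-a : ∀ {a b d} → (b - a) ∙ (d - b) ≈ d - a
  [b-a]∙[d-b]≈d-a {a} {b} {d} = begin
    (b ∙ a ⁻¹) ∙ (d ∙ b ⁻¹)  ≈⟨ wx∙yz≈yx∙wz b (a ⁻¹) d (b ⁻¹) ⟩
    (d ∙ a ⁻¹) ∙ (b ∙ b ⁻¹)  ≈⟨ ∙-congˡ (inverseʳ b) ⟩
    (d ∙ a ⁻¹) ∙ ε           ≈⟨ identityʳ _ ⟩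
    d - a                    ∎
    where open import Relation.Binary.Reasoning.Setoid setoid

  sumFin≡sum : ∀ k (f : Fin k → Carrier) → sumFin k f ≡ sum f
  sumFin≡sum ℕ.zero  f = ≡.refl
  sumFin≡sum (suc k) f = ≡.cong (f zero ∙_) (sumFin≡sum k (λ i → f (suc i)))

  sum-mono-≤ : ∀ {k} {f g : Fin k → Carrier} → (∀ i → f i ≤ g i) → sum f ≤ sum g
  sum-mono-≤ {ℕ.zero} f≤g = ≤-refl
  sum-mono-≤ {suc k}  f≤g = ∙-mono-≤ (f≤g zero) (sum-mono-≤ (λ i → f≤g (suc i)))

  ∑-⁻¹ : ∀ {k} (f : Fin k → Carrier) → sum (λ i → f i ⁻¹) ≈ sum f ⁻¹
  ∑-⁻¹ {ℕ.zero} f = sym ε⁻¹≈ε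
  ∑-⁻¹ {suc k}  f = trans (∙-congˡ (∑-⁻¹ (λ i → f (suc i)))) (⁻¹-∙-comm _ _)

  ∑-distrib-- : ∀ {k} (f g : Fin k → Carrier) → sum (λ i → f i - g i) ≈ sum f - sum g
  ∑-distrib-- f g = trans (∑-distrib-+ f (λ i → g i ⁻¹)) (∙-congˡ (∑-⁻¹ g))

  sum-zero : ∀ {k} {f : Fin k → Carrier} → (∀ i → f i ≈ ε) → sum f ≈ ε
  sum-zero {k} f≈ε = trans (sum-cong-≋ f≈ε) (sum-replicate-zero k)

  sum-single : ∀ {k} (f : Fin k → Carrier) (i : Fin k) →
               (∀ j → j ≢ i → f j ≈ ε) → sum f ≈ f i
  sum-single {suc k} f i others≈ε = begin
    sum f                              ≈⟨ sum-remove f ⟩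
    f i ∙ sum (λ j → f (punchIn i j))
      ≈⟨ ∙-congˡ (sum-zero (λ j → others≈ε _ (punchInᵢ≢i i j))) ⟩
    f i ∙ ε                            ≈⟨ identityʳ _ ⟩
    f i                                ∎
    where open import Relation.Binary.Reasoning.Setoid setoid

  sum-telescope : ∀ k (h : ℕ → Carrier) →
                  sum {k} (λ i → h (suc (toℕ i)) - h (toℕ i)) ≈ h k - h 0
  sum-telescope ℕ.zero  h = sym (inverseʳ (h 0))
  sum-telescope (suc k) h =
    trans (∙-congˡ (sum-telescope k (λ i → h (suc i)))) [b-a]∙[d-b]≈d-a

  x∈bundle⇔ : ∀ (A : Allocation n m) {ℓ} → x ∈ bundle A ℓ ⇔ A x ≡ just ℓ
  x∈bundle⇔ A {ℓ} = x∈tabulate⇔ (λ j → ≡-dec _≟ᶠ_ (A j) (just ℓ))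

  x∈prefix⇔ : ∀ (σ : Fin n ↔ Fin n) {k} →
              x ∈ prefix σ k ⇔ toℕ (Inverse.from σ x) ℕ.< k
  x∈prefix⇔ σ {k} = x∈tabulate⇔ (λ j → toℕ (Inverse.from σ j) ℕₚ.<? k)

  prefix-zero : (σ : Fin n ↔ Fin n) → prefix σ 0 ≡ ⊥
  prefix-zero σ =
    ⊆-antisym (λ x∈ → contradiction (Equivalence.to (x∈prefix⇔ σ) x∈) ℕₚ.n≮0) ⊥⊆

  prefix-full : (σ : Fin n ↔ Fin n) → prefix σ n ≡ ⊤
  prefix-full σ =
    ⊆-antisym ⊆⊤ (λ {x} _ → Equivalence.from (x∈prefix⇔ σ) (toℕ<n (Inverse.from σ x)))

  prefix-suc : (σ : Fin n ↔ Fin n) (i : Fin n) →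
               prefix σ (suc (toℕ i)) ≡ ⁅ Inverse.to σ i ⁆ ∪ prefix σ (toℕ i)
  prefix-suc σ i = ⊆-antisym grow shrink
    where
    open Inverse σ using (to; from; strictlyInverseˡ; strictlyInverseʳ)

    ∈-prefix⁻ : ∀ {x k} → x ∈ prefix σ k → toℕ (from x) ℕ.< k
    ∈-prefix⁻ = Equivalence.to (x∈prefix⇔ σ)

    ∈-prefix⁺ : ∀ {x k} → toℕ (from x) ℕ.< k → x ∈ prefix σ k
    ∈-prefix⁺ = Equivalence.from (x∈prefix⇔ σ)

    grow : prefix σ (suc (toℕ i)) ⊆ ⁅ to i ⁆ ∪ prefix σ (toℕ i)
    grow {x} x∈ with ℕₚ.m<1+n⇒m<n∨m≡n (∈-prefix⁻ x∈)
    ... | inj₁ before = x∈p∪q⁺ (inj₂ (∈-prefix⁺ before))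
    ... | inj₂ at     = x∈p∪q⁺ (inj₁ (≡.subst (_∈ ⁅ to i ⁆) to-i≡x (x∈⁅x⁆ (to i))))
      where
      to-i≡x : to i ≡ x
      to-i≡x = ≡.trans (≡.cong to (≡.sym (toℕ-injective at))) (strictlyInverseˡ x)

    shrink : ⁅ to i ⁆ ∪ prefix σ (toℕ i) ⊆ prefix σ (suc (toℕ i))
    shrink {x} x∈ with x∈p∪q⁻ _ _ x∈
    ... | inj₁ x∈⁅to-i⁆ = ∈-prefix⁺ (ℕₚ.≤-reflexive (≡.cong (suc ∘ toℕ) from-x≡i))
      where
      from-x≡i : from x ≡ i
      from-x≡i = ≡.trans (≡.cong from (x∈⁅y⁆⇒x≡y _ x∈⁅to-i⁆)) (strictlyInverseʳ i)
    ... | inj₂ x∈prefix = ∈-prefix⁺ (ℕₚ.m<n⇒m<1+n (∈-prefix⁻ x∈prefix))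

  optPrefix : Allocation n m → (Fin n ↔ Fin n) → Fin m → ℕ → Subset n
  optPrefix A* σ ℓ k = bundle A* ℓ ∩ prefix σ k

  module _ (A* : Allocation n m) (σ : Fin n ↔ Fin n) where

    optPrefix-zero : ∀ ℓ → optPrefix A* σ ℓ 0 ≡ ⊥
    optPrefix-zero ℓ = ≡.trans (≡.cong (bundle A* ℓ ∩_) (prefix-zero σ)) (∩-zeroʳ _)

    optPrefix-full : ∀ ℓ → optPrefix A* σ ℓ n ≡ bundle A* ℓ
    optPrefix-full ℓ = ≡.trans (≡.cong (bundle A* ℓ ∩_) (prefix-full σ)) (∩-identityʳ _)

    optPrefix-suc : ∀ ℓ i → optPrefix A* σ ℓ (suc (toℕ i))
                              ≡ (bundle A* ℓ ∩ ⁅ Inverse.to σ i ⁆) ∪ optPrefix A* σ ℓ (toℕ i)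
    optPrefix-suc ℓ i =
      ≡.trans (≡.cong (bundle A* ℓ ∩_) (prefix-suc σ i)) (∩-distribˡ-∪ _ _ _)

    optPrefix-suc-∈ : ∀ {ℓ} i → A* (Inverse.to σ i) ≡ just ℓ →
                      optPrefix A* σ ℓ (suc (toℕ i))
                        ≡ ⁅ Inverse.to σ i ⁆ ∪ optPrefix A* σ ℓ (toℕ i)
    optPrefix-suc-∈ {ℓ} i opt≡ℓ = ≡.trans (optPrefix-suc ℓ i)
      (≡.cong (_∪ optPrefix A* σ ℓ (toℕ i))
              (p∩⁅x⁆≡⁅x⁆ (Equivalence.from (x∈bundle⇔ A*) opt≡ℓ)))

    optPrefix-suc-∉ : ∀ {ℓ} i → A* (Inverse.to σ i) ≢ just ℓ →
                      optPrefix A* σ ℓ (suc (toℕ i)) ≡ optPrefix A* σ ℓ (toℕ i)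
    optPrefix-suc-∉ {ℓ} i opt≢ℓ = ≡.trans (optPrefix-suc ℓ i) (≡.trans
      (≡.cong (_∪ optPrefix A* σ ℓ (toℕ i))
              (p∩⁅x⁆≡⊥ (opt≢ℓ ∘ Equivalence.to (x∈bundle⇔ A*))))
      (∪-identityˡ _))

  completionGain : (Fin m → Subset n → Carrier) → Allocation n m → Allocation n m →
                   Fin m → Carrier
  completionGain vs A* A ℓ = vs ℓ (bundle A ℓ ∪ bundle A* ℓ) - vs ℓ (bundle A ℓ)

  module _ (vs : Fin m → Subset n → Carrier) (A* : Allocation n m) (σ : Fin n ↔ Fin n)
           (A : Allocation n m) where

    gainPotential : Fin m → ℕ → Carrier
    gainPotential ℓ k = vs ℓ (bundle A ℓ ∪ optPrefix A* σ ℓ k)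

    gainPotential-zero : ∀ ℓ → gainPotential ℓ 0 ≡ vs ℓ (bundle A ℓ)
    gainPotential-zero ℓ =
      ≡.cong (vs ℓ) (≡.trans (≡.cong (bundle A ℓ ∪_) (optPrefix-zero A* σ ℓ)) (∪-identityʳ _))

    gainPotential-full : ∀ ℓ → gainPotential ℓ n ≡ vs ℓ (bundle A ℓ ∪ bundle A* ℓ)
    gainPotential-full ℓ = ≡.cong (λ U → vs ℓ (bundle A ℓ ∪ U)) (optPrefix-full A* σ ℓ)

    gainPotential-step : Fin m → Fin n → Carrier
    gainPotential-step ℓ i = gainPotential ℓ (suc (toℕ i)) - gainPotential ℓ (toℕ i)

    gainPotential-step-∉ : ∀ {ℓ} i → A* (Inverse.to σ i) ≢ just ℓ →
                           gainPotential-step ℓ i ≈ ε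
    gainPotential-step-∉ {ℓ} i opt≢ℓ = trans (∙-congʳ (reflexive unchanged)) (inverseʳ _)
      where
      unchanged : gainPotential ℓ (suc (toℕ i)) ≡ gainPotential ℓ (toℕ i)
      unchanged = ≡.cong (λ U → vs ℓ (bundle A ℓ ∪ U)) (optPrefix-suc-∉ A* σ i opt≢ℓ)

    Gain≈∑-gainPotential-step : ∀ i → Gain vs A* σ (Inverse.to σ i) A
                                        ≈ sum (λ ℓ → gainPotential-step ℓ i)
    Gain≈∑-gainPotential-step i with A* (Inverse.to σ i) in opt≡
    ... | nothing = sym (sum-zero {f = λ ℓ → gainPotential-step ℓ i} all-unchanged)
      where
      all-unchanged : ∀ ℓ → gainPotential-step ℓ i ≈ ε
      all-unchanged ℓ =
        gainPotential-step-∉ i (λ opt≡ℓ → contradiction (≡.trans (≡.sym opt≡) opt≡ℓ) λ ())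
    ... | just ℓ₀ rewrite Inverse.strictlyInverseʳ σ i =
      trans (∙-congʳ (reflexive (≡.cong (vs ℓ₀) add-item)))
            (sym (sum-single (λ ℓ → gainPotential-step ℓ i) ℓ₀ others-unchanged))
      where
      add-item : ⁅ Inverse.to σ i ⁆ ∪ (bundle A ℓ₀ ∪ optPrefix A* σ ℓ₀ (toℕ i))
                 ≡ bundle A ℓ₀ ∪ optPrefix A* σ ℓ₀ (suc (toℕ i))
      add-item = ≡.trans (∪-leftComm _ _ _)
                         (≡.cong (bundle A ℓ₀ ∪_) (≡.sym (optPrefix-suc-∈ A* σ i opt≡)))

      others-unchanged : ∀ ℓ → ℓ ≢ ℓ₀ → gainPotential-step ℓ i ≈ ε
      others-unchanged ℓ ℓ≢ℓ₀ =
        gainPotential-step-∉ i (ℓ≢ℓ₀ ∘ ≡.sym ∘ just-injective ∘ ≡.trans (≡.sym opt≡))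

    ∑-Gain : sum (λ j → Gain vs A* σ j A) ≈ sum (completionGain vs A* A)
    ∑-Gain = begin
      sum (λ j → Gain vs A* σ j A)
        ≈⟨ ∑-permute _ σ ⟩
      sum (λ i → Gain vs A* σ (Inverse.to σ i) A)
        ≈⟨ sum-cong-≋ Gain≈∑-gainPotential-step ⟩
      sum (λ i → sum (λ ℓ → gainPotential-step ℓ i))
        ≈⟨ ∑-comm (λ i ℓ → gainPotential-step ℓ i) ⟩
      sum (λ ℓ → sum (λ i → gainPotential-step ℓ i))
        ≈⟨ sum-cong-≋ (λ ℓ → sum-telescope n (gainPotential ℓ)) ⟩
      sum (λ ℓ → gainPotential ℓ n - gainPotential ℓ 0)
        ≈⟨ sum-cong-≋ (λ ℓ → reflexive
             (≡.cong₂ _-_ (gainPotential-full ℓ) (gainPotential-zero ℓ))) ⟩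
      sum (completionGain vs A* A)
        ∎
      where open import Relation.Binary.Reasoning.Setoid setoid

  gainDrop≤valueGain : ∀ (v : Subset n → Carrier) → (∀ S T → S ⊆ T → v S ≤ v T) →
                       ∀ {S S′} T → S ⊆ S′ →
                       (v (S ∪ T) - v S) - (v (S′ ∪ T) - v S′) ≤ v S′ - v S
  gainDrop≤valueGain v mono {S} {S′} T S⊆S′ = begin
    (v (S ∪ T) - v S) - (v (S′ ∪ T) - v S′)  ≈⟨ ∙-congˡ (⁻¹-anti-homo‿- _ _) ⟩
    (v (S ∪ T) - v S) ∙ (v S′ - v (S′ ∪ T))  ≈⟨ wx∙yz≈yx∙wz _ _ _ _ ⟩
    (v S′ - v S) ∙ (v (S ∪ T) - v (S′ ∪ T))
      ≤⟨ ∙-mono-≤ ≤-refl (x≤y⇒x-y≤ε (mono _ _ (∪-monoˡ-⊆ S⊆S′))) ⟩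
    (v S′ - v S) ∙ ε                          ≈⟨ identityʳ _ ⟩
    v S′ - v S                                ∎
    where open import Relation.Binary.Reasoning.PartialOrder poset

  ∑-gainDrop≤welfareGain : ∀ (vs : Fin m → Subset n → Carrier) →
                           (∀ ℓ S T → S ⊆ T → vs ℓ S ≤ vs ℓ T) →
                           ∀ A* σ (A A′ : Allocation n m) → (∀ ℓ → bundle A ℓ ⊆ bundle A′ ℓ) →
                           sumFin n (λ j → Gain vs A* σ j A - Gain vs A* σ j A′)
                             ≤ welfare vs A′ - welfare vs A
  ∑-gainDrop≤welfareGain {m} {n} vs mono A* σ A A′ A⊆A′ = begin
    sumFin n (λ j → gain A j - gain A′ j)  ≡⟨ sumFin≡sum n _ ⟩
    sum (λ j → gain A j - gain A′ j)       ≈⟨ ∑-distrib-- (gain A) (gain A′) ⟩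
    sum (gain A) - sum (gain A′)
      ≈⟨ ∙-cong (∑-Gain vs A* σ A) (⁻¹-cong (∑-Gain vs A* σ A′)) ⟩
    sum (completion A) - sum (completion A′)
      ≈⟨ ∑-distrib-- (completion A) (completion A′) ⟨
    sum (λ ℓ → completion A ℓ - completion A′ ℓ)
      ≤⟨ sum-mono-≤ (λ ℓ → gainDrop≤valueGain (vs ℓ) (mono ℓ) (bundle A* ℓ) (A⊆A′ ℓ)) ⟩
    sum (λ ℓ → value A′ ℓ - value A ℓ)     ≈⟨ ∑-distrib-- (value A′) (value A) ⟩
    sum (value A′) - sum (value A)         ≡⟨ ≡.cong₂ _-_ (sumFin≡sum m _) (sumFin≡sum m _) ⟨
    welfare vs A′ - welfare vs A           ∎
    where
    open import Relation.Binary.Reasoning.PartialOrder poset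

    gain : Allocation n m → Fin n → Carrier
    gain B j = Gain vs A* σ j B

    completion : Allocation n m → Fin m → Carrier
    completion = completionGain vs A*

    value : Allocation n m → Fin m → Carrier
    value B ℓ = vs ℓ (bundle B ℓ)

  greedyAlloc-mono : ∀ (π : Fin n ↔ Fin n) (c : Fin n → Fin m) {k k′} → k ℕ.≤ k′ →
                     ∀ {j ℓ} → greedyAlloc π c k j ≡ just ℓ → greedyAlloc π c k′ j ≡ just ℓ
  greedyAlloc-mono π c {k} {k′} k≤k′ {j} =
    if-does-just-mono (toℕ (Inverse.from π j) ℕₚ.<? k) (toℕ (Inverse.from π j) ℕₚ.<? k′)
      (λ arrived → ℕₚ.<-≤-trans arrived k≤k′)

  bundle-greedyAlloc-⊆ : ∀ (π : Fin n ↔ Fin n) (c : Fin n → Fin m) {k k′ ℓ} → k ℕ.≤ k′ →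
                         bundle (greedyAlloc π c k) ℓ ⊆ bundle (greedyAlloc π c k′) ℓ
  bundle-greedyAlloc-⊆ π c {k} {k′} k≤k′ x∈ =
    Equivalence.from (x∈bundle⇔ (greedyAlloc π c k′))
      (greedyAlloc-mono π c k≤k′ (Equivalence.to (x∈bundle⇔ (greedyAlloc π c k)) x∈))

lemma2p4 : ∀ {c ℓ₁ ℓ₂ : Level} (G : OrderedAbelianGroup c ℓ₁ ℓ₂) →
    let open OrderedAbelianGroup G
        open Setting G
    in (n m : ℕ) (vs : Fin m → Subset n → Carrier) →
       (∀ ℓ → IsMonotoneSubmodular (vs ℓ)) →
       (A* : Allocation n m) → IsOptimal vs A* →
       (σ π : Fin n ↔ Fin n) (c : Fin n → Fin m) → IsGreedy vs π c →
       (p : Fin n) →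
       sumFin n (λ j → Gain vs A* σ j (greedyAlloc π c (toℕ p))
                       - Gain vs A* σ j (greedyAlloc π c (suc (toℕ p))))
         ≤ (welfare vs (greedyAlloc π c (suc (toℕ p)))
            - welfare vs (greedyAlloc π c (toℕ p)))
lemma2p4 G n m vs mono A* _ σ π c _ p =
  ∑-gainDrop≤welfareGain vs (λ ℓ → IsMonotoneSubmodular.monotone (mono ℓ)) A* σ _ _
    (λ ℓ → bundle-greedyAlloc-⊆ π c (ℕₚ.n≤1+n (toℕ p)))
  where
  open Setting G using (IsMonotoneSubmodular)
  open WelfareAccounting G
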